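{- Let $m\in\mathbb{Z}_{\ge0}$ and $k\in\mathbb{Z}$. Then \[ \sum_{i=0}^{m}\binom{m}{i}S_{m-i}(m-k-1)S_i(k)=m!. \]
   Context: The Stirling polynomials $S_j(x)\in\mathbb{Q}[x]$ ($j\ge0$) are defined by requiring $\binom{\ell}{j}S_j(\ell)=\sigma_j(\ell,\ell-1,\dots,1)$ for every positive integer $\ell$, where $\sigma_j$ is the $j$-th elementary symmetric polynomial and $\binom{x}{j}=x(x-1)\cdots(x-j+1)/j!$ as a polynomial in $x$. -}

module Defs where

open import Data.Nat as ℕ using (ℕ; zero; suc)
open import Data.Integer as ℤ using (ℤ; +_)
open import Data.Rational using (ℚ; _+_; _*_; _/_; 0ℚ; 1ℚ)
open import Data.List using (List; []; _∷_; map; foldr; upTo)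
open import Data.Nat.Combinatorics using (_C_)
open import Relation.Binary.PropositionalEquality using (_≡_)

-- Polynomials in ℚ[x] as coefficient lists, lowest degree first:
-- a₀ ∷ a₁ ∷ … represents a₀ + a₁ x + …
Poly : Set
Poly = List ℚ

eval : Poly → ℚ → ℚ
eval []       x = 0ℚ
eval (a ∷ as) x = a + x * eval as x

ℕ→ℚ : ℕ → ℚ
ℕ→ℚ n = (+ n) / 1

ℤ→ℚ : ℤ → ℚ
ℤ→ℚ z = z / 1

σ : ℕ → List ℚ → ℚ
σ zero    xs       = 1ℚ
σ (suc j) []       = 0ℚ
σ (suc j) (x ∷ xs) = x * σ j xs + σ (suc j) xs

down : ℕ → List ℚ
down zero    = []
down (suc n) = ℕ→ℚ (suc n) ∷ down n

-- S is a family of Stirling polynomials: binom(ℓ, j) S_j(ℓ) = σ_j(ℓ, …, 1)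
-- for every j ≥ 0 and every positive integer ℓ.  (For ℓ ∈ ℕ the value of the
-- polynomial binom(x, j) at x = ℓ is the ordinary binomial coefficient ℓ C j.)
IsStirlingFamily : (ℕ → Poly) → Set
IsStirlingFamily S =
  ∀ (j ℓ : ℕ) → ℕ→ℚ (suc ℓ C j) * eval (S j) (ℕ→ℚ (suc ℓ)) ≡ σ j (down (suc ℓ))

sumTo : ℕ → (ℕ → ℚ) → ℚ
sumTo m f = foldr _+_ 0ℚ (map f (upTo (suc m)))

module Submission where

-- Put Q_j(x) = j!·binom(x, j)·S_j(x) = x(x-1)⋯(x-j+1)·S_j(x). At a natural number n the defining
-- property gives Q_j(n) = j!·σ_j(n, …, 1); the recurrence of the σ_j, being a polynomial identity,
-- extends to all x and then yields Q_j(-(n+1)) = j!·h_j(n, …, 1) with h_j complete homogeneous.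
-- Multiplying the i-th summand by x(x-1)⋯(x-m+1) makes it m!·(-1)^(m-i)·Q_(m-i)(m-1-x)/(m-i)!·Q_i(x)/i!.
-- At x = m + c this is m! times the coefficient of t^m in ∏_{k≤c} (1+kt)⁻¹ · ∏_{k≤m+c} (1+kt),
-- i.e. in ∏_{k=c+1}^{m+c} (1+kt), namely m!·(m+c)(m+c-1)⋯(c+1) = m!·x(x-1)⋯(x-m+1).
-- So the sum, a polynomial in x, equals m! at all integers x ≥ m, hence everywhere.

open import Algebra.Properties.Group using (x∙y⁻¹≈ε⇒x≈y)
open import Data.Integer as ℤ using (ℤ; +_)
import Data.Integer.Properties as ℤₚ
open import Data.List using (List; []; _∷_; length; foldr; map; upTo)
open import Data.List.Properties using (map-upTo)
open import Data.Nat as ℕ using (ℕ; zero; suc; _∸_; _!; _≤_; _<_; z≤n; s≤s)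
open import Data.Nat.Combinatorics using (_C_; k![n∸k]!∣n!; nCk+nC[k+1]≡[n+1]C[k+1])
open import Data.Nat.Combinatorics.Specification using (nCk≡n!/k![n-k]!)
open import Data.Nat.DivMod using (m/n*n≡m)
import Data.Nat.Properties as ℕₚ
open import Data.Nat.Properties using (_!*_!≢0)
open import Data.Product using (Σ-syntax; _,_)
open import Data.Rational using (ℚ; _+_; _*_; _-_; -_; 0ℚ; 1ℚ; 1/_; ≢-nonZero)
open import Data.Rational.Literals using (fromℤ)
import Data.Rational.Properties as ℚₚ
open import Data.Rational.Solver using (module +-*-Solver)
open import Function using (_∘_)
open import Relation.Binary.PropositionalEquality

open import Defs

open +-*-Solver
open ≡-Reasoning

ℤ→ℚ≡fromℤ : ∀ z → ℤ→ℚ z ≡ fromℤ z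
ℤ→ℚ≡fromℤ z = ℚₚ.↥p/↧p≡p (fromℤ z)

-- fromℤ a + fromℤ b and fromℤ a * fromℤ b compute to ℤ→ℚ of the integer expression.
ℤ→ℚ-+ : ∀ a b → ℤ→ℚ (a ℤ.+ b) ≡ ℤ→ℚ a + ℤ→ℚ b
ℤ→ℚ-+ a b = begin
  ℤ→ℚ (a ℤ.+ b)      ≡⟨ cong ℤ→ℚ (cong₂ ℤ._+_ (ℤₚ.*-identityʳ a) (ℤₚ.*-identityʳ b)) ⟨
  fromℤ a + fromℤ b  ≡⟨ cong₂ _+_ (ℤ→ℚ≡fromℤ a) (ℤ→ℚ≡fromℤ b) ⟨
  ℤ→ℚ a + ℤ→ℚ b      ∎

ℤ→ℚ-* : ∀ a b → ℤ→ℚ (a ℤ.* b) ≡ ℤ→ℚ a * ℤ→ℚ b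
ℤ→ℚ-* a b = sym (cong₂ _*_ (ℤ→ℚ≡fromℤ a) (ℤ→ℚ≡fromℤ b))

ℤ→ℚ-neg : ∀ a → ℤ→ℚ (ℤ.- a) ≡ - ℤ→ℚ a
ℤ→ℚ-neg a = trans (ℤ→ℚ≡fromℤ (ℤ.- a)) (trans (fromℤ-neg a) (cong -_ (sym (ℤ→ℚ≡fromℤ a))))
  where
  fromℤ-neg : ∀ a → fromℤ (ℤ.- a) ≡ - fromℤ a
  fromℤ-neg (+ zero)    = refl
  fromℤ-neg (+ suc n)   = refl
  fromℤ-neg ℤ.-[1+ n ] = refl

ℤ→ℚ-- : ∀ a b → ℤ→ℚ (a ℤ.- b) ≡ ℤ→ℚ a - ℤ→ℚ b
ℤ→ℚ-- a b = trans (ℤ→ℚ-+ a (ℤ.- b)) (cong (λ q → ℤ→ℚ a + q) (ℤ→ℚ-neg b))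

ℤ→ℚ-complement : ∀ m k → ℤ→ℚ (+ m ℤ.- k ℤ.- + 1) ≡ ℕ→ℚ m - ℤ→ℚ k - 1ℚ
ℤ→ℚ-complement m k = trans (ℤ→ℚ-- (+ m ℤ.- k) (+ 1)) (cong (_- 1ℚ) (ℤ→ℚ-- (+ m) k))

ℕ→ℚ-+ : ∀ a b → ℕ→ℚ (a ℕ.+ b) ≡ ℕ→ℚ a + ℕ→ℚ b
ℕ→ℚ-+ a b = ℤ→ℚ-+ (+ a) (+ b)

ℕ→ℚ-* : ∀ a b → ℕ→ℚ (a ℕ.* b) ≡ ℕ→ℚ a * ℕ→ℚ b
ℕ→ℚ-* a b = trans (cong ℤ→ℚ (ℤₚ.pos-* a b)) (ℤ→ℚ-* (+ a) (+ b))

ℕ→ℚ-suc : ∀ n → ℕ→ℚ (suc n) ≡ ℕ→ℚ n + 1ℚ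
ℕ→ℚ-suc n = trans (ℕ→ℚ-+ 1 n) (ℚₚ.+-comm 1ℚ (ℕ→ℚ n))

ℕ→ℚ-suc≢0 : ∀ n → ℕ→ℚ (suc n) ≢ 0ℚ
ℕ→ℚ-suc≢0 n eq with trans (sym (ℤ→ℚ≡fromℤ (+ suc n))) eq
... | ()

x*y≡0⇒y≡0 : ∀ {x y} → x ≢ 0ℚ → x * y ≡ 0ℚ → y ≡ 0ℚ
x*y≡0⇒y≡0 {x} {y} x≢0 xy≡0 = begin
  y               ≡⟨ ℚₚ.*-identityˡ y ⟨
  1ℚ * y          ≡⟨ cong (_* y) (ℚₚ.*-inverseˡ x) ⟨
  1/ x * x * y    ≡⟨ ℚₚ.*-assoc (1/ x) x y ⟩
  1/ x * (x * y)  ≡⟨ cong (1/ x *_) xy≡0 ⟩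
  1/ x * 0ℚ       ≡⟨ ℚₚ.*-zeroʳ (1/ x) ⟩
  0ℚ              ∎
  where instance _ = ≢-nonZero x≢0

*-≢0 : ∀ {x y} → x ≢ 0ℚ → y ≢ 0ℚ → x * y ≢ 0ℚ
*-≢0 x≢0 y≢0 = y≢0 ∘ x*y≡0⇒y≡0 x≢0

x-y≡0⇒x≡y : ∀ {x y} → x - y ≡ 0ℚ → x ≡ y
x-y≡0⇒x≡y = x∙y⁻¹≈ε⇒x≈y ℚₚ.+-0-group _ _

*-cancelˡ-≢0 : ∀ {x y z} → x ≢ 0ℚ → x * y ≡ x * z → y ≡ z
*-cancelˡ-≢0 {x} {y} {z} x≢0 xy≡xz = x-y≡0⇒x≡y (x*y≡0⇒y≡0 x≢0 (begin
  x * (y - z)    ≡⟨ solve 3 (λ x y z → x :* (y :- z) := x :* y :- x :* z) refl x y z ⟩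
  x * y - x * z  ≡⟨ cong (_- x * z) xy≡xz ⟩
  x * z - x * z  ≡⟨ ℚₚ.+-inverseʳ (x * z) ⟩
  0ℚ             ∎))

-- Polynomial functions and their identity theorem

infixl 6 _+ₚ_
infixl 7 _·ₚ_ _*ₚ_

_+ₚ_ : Poly → Poly → Poly
[]      +ₚ q       = q
(a ∷ p) +ₚ []      = a ∷ p
(a ∷ p) +ₚ (b ∷ q) = a + b ∷ p +ₚ q

_·ₚ_ : ℚ → Poly → Poly
c ·ₚ p = map (c *_) p

_*ₚ_ : Poly → Poly → Poly
[]      *ₚ q = []
(a ∷ p) *ₚ q = a ·ₚ q +ₚ (0ℚ ∷ p *ₚ q)

eval-+ₚ : ∀ p q x → eval (p +ₚ q) x ≡ eval p x + eval q x
eval-+ₚ []      q       x = sym (ℚₚ.+-identityˡ (eval q x))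
eval-+ₚ (a ∷ p) []      x = sym (ℚₚ.+-identityʳ (eval (a ∷ p) x))
eval-+ₚ (a ∷ p) (b ∷ q) x = begin
  a + b + x * eval (p +ₚ q) x            ≡⟨ cong (λ v → a + b + x * v) (eval-+ₚ p q x) ⟩
  a + b + x * (eval p x + eval q x)      ≡⟨ solve 5 (λ a b x u v → a :+ b :+ x :* (u :+ v) := a :+ x :* u :+ (b :+ x :* v))
                                              refl a b x (eval p x) (eval q x) ⟩
  a + x * eval p x + (b + x * eval q x)  ∎

eval-·ₚ : ∀ c p x → eval (c ·ₚ p) x ≡ c * eval p x
eval-·ₚ c []      x = sym (ℚₚ.*-zeroʳ c)
eval-·ₚ c (a ∷ p) x = begin
  c * a + x * eval (c ·ₚ p) x  ≡⟨ cong (λ v → c * a + x * v) (eval-·ₚ c p x) ⟩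
  c * a + x * (c * eval p x)   ≡⟨ solve 4 (λ c a x u → c :* a :+ x :* (c :* u) := c :* (a :+ x :* u)) refl c a x (eval p x) ⟩
  c * (a + x * eval p x)       ∎

eval-*ₚ : ∀ p q x → eval (p *ₚ q) x ≡ eval p x * eval q x
eval-*ₚ []      q x = sym (ℚₚ.*-zeroˡ (eval q x))
eval-*ₚ (a ∷ p) q x = begin
  eval (a ·ₚ q +ₚ (0ℚ ∷ p *ₚ q)) x                ≡⟨ eval-+ₚ (a ·ₚ q) (0ℚ ∷ p *ₚ q) x ⟩
  eval (a ·ₚ q) x + (0ℚ + x * eval (p *ₚ q) x)    ≡⟨ cong₂ (λ u v → u + (0ℚ + x * v)) (eval-·ₚ a q x) (eval-*ₚ p q x) ⟩
  a * eval q x + (0ℚ + x * (eval p x * eval q x)) ≡⟨ solve 4 (λ a x u v → a :* v :+ (con 0ℚ :+ x :* (u :* v)) := (a :+ x :* u) :* v)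
                                                       refl a x (eval p x) (eval q x) ⟩
  (a + x * eval p x) * eval q x                   ∎

IsPolynomial : (ℚ → ℚ) → Set
IsPolynomial f = Σ[ p ∈ Poly ] (∀ x → f x ≡ eval p x)

isPolynomial-eval : ∀ p → IsPolynomial (eval p)
isPolynomial-eval p = p , λ _ → refl

isPolynomial-resp : ∀ {f g} → (∀ x → f x ≡ g x) → IsPolynomial f → IsPolynomial g
isPolynomial-resp f≡g (p , f≡p) = p , λ x → trans (sym (f≡g x)) (f≡p x)

isPolynomial-const : ∀ c → IsPolynomial (λ _ → c)
isPolynomial-const c = c ∷ [] , λ x → solve 2 (λ c x → c := c :+ x :* con 0ℚ) refl c x

isPolynomial-id : IsPolynomial (λ x → x)
isPolynomial-id = 0ℚ ∷ 1ℚ ∷ [] , λ x → solve 1 (λ x → x := con 0ℚ :+ x :* (con 1ℚ :+ x :* con 0ℚ)) refl x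

isPolynomial-+ : ∀ {f g} → IsPolynomial f → IsPolynomial g → IsPolynomial (λ x → f x + g x)
isPolynomial-+ (p , f≡p) (q , g≡q) = p +ₚ q , λ x → trans (cong₂ _+_ (f≡p x) (g≡q x)) (sym (eval-+ₚ p q x))

isPolynomial-* : ∀ {f g} → IsPolynomial f → IsPolynomial g → IsPolynomial (λ x → f x * g x)
isPolynomial-* (p , f≡p) (q , g≡q) = p *ₚ q , λ x → trans (cong₂ _*_ (f≡p x) (g≡q x)) (sym (eval-*ₚ p q x))

isPolynomial-- : ∀ {f g} → IsPolynomial f → IsPolynomial g → IsPolynomial (λ x → f x - g x)
isPolynomial-- {g = g} f-poly (q , g≡q) = isPolynomial-+ f-poly (- 1ℚ ·ₚ q , λ x → begin
  - g x              ≡⟨ solve 1 (λ y → :- y := con (- 1ℚ) :* y) refl (g x) ⟩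
  - 1ℚ * g x         ≡⟨ cong (- 1ℚ *_) (g≡q x) ⟩
  - 1ℚ * eval q x    ≡⟨ eval-·ₚ (- 1ℚ) q x ⟨
  eval (- 1ℚ ·ₚ q) x ∎)

isPolynomial-∘ : ∀ {f g} → IsPolynomial f → IsPolynomial g → IsPolynomial (f ∘ g)
isPolynomial-∘ {g = g} (p , f≡p) g-poly = isPolynomial-resp (λ x → sym (f≡p (g x))) (eval∘g p)
  where
  eval∘g : ∀ p → IsPolynomial (λ x → eval p (g x))
  eval∘g []      = isPolynomial-const 0ℚ
  eval∘g (a ∷ p) = isPolynomial-+ (isPolynomial-const a) (isPolynomial-* g-poly (eval∘g p))

divideBy : ℚ → Poly → Poly
divideBy r []          = []
divideBy r (a ∷ [])    = []
divideBy r (a ∷ b ∷ p) = eval (b ∷ p) r ∷ divideBy r (b ∷ p)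

eval-divideBy : ∀ r p x → eval p x ≡ (x - r) * eval (divideBy r p) x + eval p r
eval-divideBy r []          x = solve 2 (λ x r → con 0ℚ := (x :- r) :* con 0ℚ :+ con 0ℚ) refl x r
eval-divideBy r (a ∷ [])    x = solve 3 (λ a x r → a :+ x :* con 0ℚ := (x :- r) :* con 0ℚ :+ (a :+ r :* con 0ℚ)) refl a x r
eval-divideBy r (a ∷ b ∷ p) x = begin
  a + x * eval (b ∷ p) x                ≡⟨ cong (λ v → a + x * v) (eval-divideBy r (b ∷ p) x) ⟩
  a + x * ((x - r) * eval q x + eval (b ∷ p) r)
    ≡⟨ solve 5 (λ a x r u v → a :+ x :* ((x :- r) :* u :+ v) := (x :- r) :* (v :+ x :* u) :+ (a :+ r :* v))
         refl a x r (eval q x) (eval (b ∷ p) r) ⟩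
  (x - r) * eval (divideBy r (a ∷ b ∷ p)) x + eval (a ∷ b ∷ p) r  ∎
  where q = divideBy r (b ∷ p)

length-divideBy : ∀ r a p → length (divideBy r (a ∷ p)) ≡ length p
length-divideBy r a []      = refl
length-divideBy r a (b ∷ p) = cong suc (length-divideBy r b p)

VanishesFrom : ℕ → (ℚ → ℚ) → Set
VanishesFrom M f = ∀ ℓ → f (ℕ→ℚ (M ℕ.+ ℓ)) ≡ 0ℚ

vanishesFrom-start : ∀ M f → VanishesFrom M f → f (ℕ→ℚ M) ≡ 0ℚ
vanishesFrom-start M f f-vanishes = subst (λ n → f (ℕ→ℚ n) ≡ 0ℚ) (ℕₚ.+-identityʳ M) (f-vanishes 0)

divideBy-vanishesFrom : ∀ M p → VanishesFrom M (eval p) → VanishesFrom (suc M) (eval (divideBy (ℕ→ℚ M) p))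
divideBy-vanishesFrom M p p-vanishes ℓ = x*y≡0⇒y≡0 (ℕ→ℚ-suc≢0 ℓ) (begin
  ℕ→ℚ (suc ℓ) * eval q y        ≡⟨ cong (_* eval q y) y-r≡1+ℓ ⟨
  (y - r) * eval q y            ≡⟨ ℚₚ.+-identityʳ _ ⟨
  (y - r) * eval q y + 0ℚ       ≡⟨ cong (λ v → (y - r) * eval q y + v) (vanishesFrom-start M (eval p) p-vanishes) ⟨
  (y - r) * eval q y + eval p r ≡⟨ eval-divideBy r p y ⟨
  eval p y                      ≡⟨ cong (eval p ∘ ℕ→ℚ) (ℕₚ.+-suc M ℓ) ⟨
  eval p (ℕ→ℚ (M ℕ.+ suc ℓ))   ≡⟨ p-vanishes (suc ℓ) ⟩
  0ℚ                            ∎)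
  where
  r = ℕ→ℚ M
  y = ℕ→ℚ (suc (M ℕ.+ ℓ))
  q = divideBy r p
  y-r≡1+ℓ : y - r ≡ ℕ→ℚ (suc ℓ)
  y-r≡1+ℓ = begin
    ℕ→ℚ (suc (M ℕ.+ ℓ)) - r       ≡⟨ cong (λ n → ℕ→ℚ n - r) (ℕₚ.+-suc M ℓ) ⟨
    ℕ→ℚ (M ℕ.+ suc ℓ) - r         ≡⟨ cong (_- r) (ℕ→ℚ-+ M (suc ℓ)) ⟩
    r + ℕ→ℚ (suc ℓ) - r           ≡⟨ solve 2 (λ r n → r :+ n :- r := n) refl r (ℕ→ℚ (suc ℓ)) ⟩
    ℕ→ℚ (suc ℓ)                   ∎

vanishesFrom⇒≡0 : ∀ {n} p → length p ≡ n → ∀ M → VanishesFrom M (eval p) → ∀ x → eval p x ≡ 0ℚ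
vanishesFrom⇒≡0         []      _   _ _          _ = refl
vanishesFrom⇒≡0 {suc n} (a ∷ p) len M p-vanishes x = begin
  eval (a ∷ p) x                      ≡⟨ eval-divideBy r (a ∷ p) x ⟩
  (x - r) * eval q x + eval (a ∷ p) r ≡⟨ cong₂ (λ u v → (x - r) * u + v) q≡0 (vanishesFrom-start M (eval (a ∷ p)) p-vanishes) ⟩
  (x - r) * 0ℚ + 0ℚ                   ≡⟨ solve 2 (λ x r → (x :- r) :* con 0ℚ :+ con 0ℚ := con 0ℚ) refl x r ⟩
  0ℚ                                  ∎
  where
  r = ℕ→ℚ M
  q = divideBy r (a ∷ p)
  q≡0 : eval q x ≡ 0ℚ
  q≡0 = vanishesFrom⇒≡0 q (trans (length-divideBy r a p) (ℕₚ.suc-injective len))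
          (suc M) (divideBy-vanishesFrom M (a ∷ p) p-vanishes) x

polynomial-unique : ∀ {f g} → IsPolynomial f → IsPolynomial g → ∀ M →
                    (∀ ℓ → f (ℕ→ℚ (M ℕ.+ ℓ)) ≡ g (ℕ→ℚ (M ℕ.+ ℓ))) → ∀ x → f x ≡ g x
polynomial-unique {f} {g} f-poly g-poly M f≡g x with isPolynomial-- f-poly g-poly
... | d , f-g≡d = x-y≡0⇒x≡y (trans (f-g≡d x) (vanishesFrom⇒≡0 d refl M d-vanishes x))
  where
  d-vanishes : VanishesFrom M (eval d)
  d-vanishes ℓ = begin
    eval d y     ≡⟨ f-g≡d y ⟨
    f y - g y    ≡⟨ cong (_- g y) (f≡g ℓ) ⟩
    g y - g y    ≡⟨ ℚₚ.+-inverseʳ (g y) ⟩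
    0ℚ           ∎
    where y = ℕ→ℚ (M ℕ.+ ℓ)

-- Falling factorials

sign : ℕ → ℚ
sign zero    = 1ℚ
sign (suc j) = - sign j

infixl 8 _↓_

_↓_ : ℚ → ℕ → ℚ
x ↓ zero  = 1ℚ
x ↓ suc j = x ↓ j * (x - ℕ→ℚ j)

isPolynomial-↓ : ∀ j → IsPolynomial (_↓ j)
isPolynomial-↓ zero    = isPolynomial-const 1ℚ
isPolynomial-↓ (suc j) = isPolynomial-* (isPolynomial-↓ j) (isPolynomial-- isPolynomial-id (isPolynomial-const (ℕ→ℚ j)))

↓-sucˡ : ∀ x j → x ↓ suc j ≡ x * (x - 1ℚ) ↓ j
↓-sucˡ x zero    = solve 1 (λ x → con 1ℚ :* (x :- con 0ℚ) := x :* con 1ℚ) refl x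
↓-sucˡ x (suc j) = begin
  x ↓ suc j * (x - ℕ→ℚ (suc j))                ≡⟨ cong₂ (λ u n → u * (x - n)) (↓-sucˡ x j) (ℕ→ℚ-suc j) ⟩
  x * (x - 1ℚ) ↓ j * (x - (ℕ→ℚ j + 1ℚ))        ≡⟨ solve 3 (λ x f n → x :* f :* (x :- (n :+ con 1ℚ)) := x :* (f :* (x :- con 1ℚ :- n)))
                                                     refl x ((x - 1ℚ) ↓ j) (ℕ→ℚ j) ⟩
  x * ((x - 1ℚ) ↓ j * (x - 1ℚ - ℕ→ℚ j))        ∎

ℕ→ℚ-suc-↓ : ∀ n j → ℕ→ℚ (suc n) ↓ suc j ≡ ℕ→ℚ (suc n) * ℕ→ℚ n ↓ j
ℕ→ℚ-suc-↓ n j = trans (↓-sucˡ (ℕ→ℚ (suc n)) j) (cong (λ y → ℕ→ℚ (suc n) * y ↓ j) (begin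
  ℕ→ℚ (suc n) - 1ℚ   ≡⟨ cong (_- 1ℚ) (ℕ→ℚ-suc n) ⟩
  ℕ→ℚ n + 1ℚ - 1ℚ    ≡⟨ solve 1 (λ n → n :+ con 1ℚ :- con 1ℚ := n) refl (ℕ→ℚ n) ⟩
  ℕ→ℚ n              ∎))

0↓suc : ∀ j → 0ℚ ↓ suc j ≡ 0ℚ
0↓suc j = trans (↓-sucˡ 0ℚ j) (ℚₚ.*-zeroˡ ((0ℚ - 1ℚ) ↓ j))

↓-+ : ∀ x i j → x ↓ (i ℕ.+ j) ≡ x ↓ i * (x - ℕ→ℚ i) ↓ j
↓-+ x zero    j = begin
  x ↓ j               ≡⟨ cong (_↓ j) (solve 1 (λ x → x := x :- con 0ℚ) refl x) ⟩
  (x - 0ℚ) ↓ j        ≡⟨ ℚₚ.*-identityˡ _ ⟨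
  1ℚ * (x - 0ℚ) ↓ j   ∎
↓-+ x (suc i) j = begin
  x ↓ suc (i ℕ.+ j)                          ≡⟨ ↓-sucˡ x (i ℕ.+ j) ⟩
  x * (x - 1ℚ) ↓ (i ℕ.+ j)                   ≡⟨ cong (x *_) (↓-+ (x - 1ℚ) i j) ⟩
  x * ((x - 1ℚ) ↓ i * (x - 1ℚ - ℕ→ℚ i) ↓ j)  ≡⟨ cong (λ y → x * ((x - 1ℚ) ↓ i * y ↓ j)) x-1-i≡x-[1+i] ⟩
  x * ((x - 1ℚ) ↓ i * (x - ℕ→ℚ (suc i)) ↓ j) ≡⟨ ℚₚ.*-assoc x _ _ ⟨
  x * (x - 1ℚ) ↓ i * (x - ℕ→ℚ (suc i)) ↓ j   ≡⟨ cong (_* (x - ℕ→ℚ (suc i)) ↓ j) (↓-sucˡ x i) ⟨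
  x ↓ suc i * (x - ℕ→ℚ (suc i)) ↓ j          ∎
  where
  x-1-i≡x-[1+i] : x - 1ℚ - ℕ→ℚ i ≡ x - ℕ→ℚ (suc i)
  x-1-i≡x-[1+i] = trans (solve 2 (λ x n → x :- con 1ℚ :- n := x :- (n :+ con 1ℚ)) refl x (ℕ→ℚ i))
                        (cong (λ n → x - n) (sym (ℕ→ℚ-suc i)))

↓-reflect : ∀ y j → y ↓ j ≡ sign j * (ℕ→ℚ j - 1ℚ - y) ↓ j
↓-reflect y zero    = sym (ℚₚ.*-identityˡ 1ℚ)
↓-reflect y (suc j) = begin
  y ↓ j * (y - ℕ→ℚ j)                              ≡⟨ cong (_* (y - ℕ→ℚ j)) (↓-reflect y j) ⟩
  sign j * (ℕ→ℚ j - 1ℚ - y) ↓ j * (y - ℕ→ℚ j)      ≡⟨ solve 4 (λ s f n y → s :* f :* (y :- n) := :- s :* ((n :- y) :* f))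
                                                        refl (sign j) ((ℕ→ℚ j - 1ℚ - y) ↓ j) (ℕ→ℚ j) y ⟩
  - sign j * ((ℕ→ℚ j - y) * (ℕ→ℚ j - 1ℚ - y) ↓ j)  ≡⟨ cong (λ z → - sign j * ((ℕ→ℚ j - y) * z ↓ j))
                                                        (solve 2 (λ n y → n :- con 1ℚ :- y := n :- y :- con 1ℚ) refl (ℕ→ℚ j) y) ⟩
  - sign j * ((ℕ→ℚ j - y) * (ℕ→ℚ j - y - 1ℚ) ↓ j)  ≡⟨ cong (- sign j *_) (↓-sucˡ (ℕ→ℚ j - y) j) ⟨
  - sign j * (ℕ→ℚ j - y) ↓ suc j                   ≡⟨ cong (λ z → - sign j * z ↓ suc j) j-y≡j+1-1-y ⟩
  - sign j * (ℕ→ℚ (suc j) - 1ℚ - y) ↓ suc j        ∎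
  where
  j-y≡j+1-1-y : ℕ→ℚ j - y ≡ ℕ→ℚ (suc j) - 1ℚ - y
  j-y≡j+1-1-y = trans (solve 2 (λ n y → n :- y := n :+ con 1ℚ :- con 1ℚ :- y) refl (ℕ→ℚ j) y)
                      (cong (λ n → n - 1ℚ - y) (sym (ℕ→ℚ-suc j)))

↓-+-reflect : ∀ x i j → x ↓ (i ℕ.+ j) ≡ x ↓ i * (sign j * (ℕ→ℚ (i ℕ.+ j) - x - 1ℚ) ↓ j)
↓-+-reflect x i j = trans (↓-+ x i j) (cong (x ↓ i *_) (trans (↓-reflect (x - ℕ→ℚ i) j)
  (cong (λ z → sign j * z ↓ j) (begin
    ℕ→ℚ j - 1ℚ - (x - ℕ→ℚ i)   ≡⟨ solve 3 (λ i j x → j :- con 1ℚ :- (x :- i) := i :+ j :- x :- con 1ℚ) refl (ℕ→ℚ i) (ℕ→ℚ j) x ⟩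
    ℕ→ℚ i + ℕ→ℚ j - x - 1ℚ     ≡⟨ cong (λ n → n - x - 1ℚ) (ℕ→ℚ-+ i j) ⟨
    ℕ→ℚ (i ℕ.+ j) - x - 1ℚ     ∎))))

ℕ→ℚ-↓≢0 : ∀ j c → ℕ→ℚ (j ℕ.+ c) ↓ j ≢ 0ℚ
ℕ→ℚ-↓≢0 zero    c = ℚₚ.1≢0
ℕ→ℚ-↓≢0 (suc j) c = *-≢0 (ℕ→ℚ-suc≢0 (j ℕ.+ c)) (ℕ→ℚ-↓≢0 j c) ∘ trans (sym (ℕ→ℚ-suc-↓ (j ℕ.+ c) j))

C*!≡↓ : ∀ n k → ℕ→ℚ (n C k) * ℕ→ℚ (k !) ≡ ℕ→ℚ n ↓ k
C*!≡↓ n       zero    = refl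
C*!≡↓ zero    (suc k) = trans (ℚₚ.*-zeroˡ (ℕ→ℚ (suc k !))) (sym (0↓suc k))
C*!≡↓ (suc n) (suc k) = begin
  ℕ→ℚ (suc n C suc k) * ℕ→ℚ (suc k !)
    ≡⟨ cong₂ _*_ (trans (cong ℕ→ℚ (sym (nCk+nC[k+1]≡[n+1]C[k+1] n k))) (ℕ→ℚ-+ (n C k) (n C suc k))) (ℕ→ℚ-* (suc k) (k !)) ⟩
  (c₀ + c₁) * (ℕ→ℚ (suc k) * k!)
    ≡⟨ solve 4 (λ c₀ c₁ s f → (c₀ :+ c₁) :* (s :* f) := s :* (c₀ :* f) :+ c₁ :* (s :* f)) refl c₀ c₁ (ℕ→ℚ (suc k)) k! ⟩
  ℕ→ℚ (suc k) * (c₀ * k!) + c₁ * (ℕ→ℚ (suc k) * k!)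
    ≡⟨ cong₂ (λ u v → ℕ→ℚ (suc k) * u + c₁ * v) (C*!≡↓ n k) (sym (ℕ→ℚ-* (suc k) (k !))) ⟩
  ℕ→ℚ (suc k) * ℕ→ℚ n ↓ k + ℕ→ℚ (n C suc k) * ℕ→ℚ (suc k !)
    ≡⟨ cong₂ (λ s v → s * ℕ→ℚ n ↓ k + v) (ℕ→ℚ-suc k) (C*!≡↓ n (suc k)) ⟩
  (ℕ→ℚ k + 1ℚ) * ℕ→ℚ n ↓ k + ℕ→ℚ n ↓ k * (ℕ→ℚ n - ℕ→ℚ k)
    ≡⟨ solve 3 (λ k n f → (k :+ con 1ℚ) :* f :+ f :* (n :- k) := (n :+ con 1ℚ) :* f) refl (ℕ→ℚ k) (ℕ→ℚ n) (ℕ→ℚ n ↓ k) ⟩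
  (ℕ→ℚ n + 1ℚ) * ℕ→ℚ n ↓ k
    ≡⟨ cong (_* ℕ→ℚ n ↓ k) (ℕ→ℚ-suc n) ⟨
  ℕ→ℚ (suc n) * ℕ→ℚ n ↓ k
    ≡⟨ ℕ→ℚ-suc-↓ n k ⟨
  ℕ→ℚ (suc n) ↓ suc k ∎
  where
  c₀ = ℕ→ℚ (n C k)
  c₁ = ℕ→ℚ (n C suc k)
  k! = ℕ→ℚ (k !)

C*!*!≡! : ∀ {m i} → i ≤ m → ℕ→ℚ (m C i) * (ℕ→ℚ (i !) * ℕ→ℚ ((m ∸ i) !)) ≡ ℕ→ℚ (m !)
C*!*!≡! {m} {i} i≤m = begin
  ℕ→ℚ (m C i) * (ℕ→ℚ (i !) * ℕ→ℚ ((m ∸ i) !))  ≡⟨ cong (ℕ→ℚ (m C i) *_) (ℕ→ℚ-* (i !) ((m ∸ i) !)) ⟨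
  ℕ→ℚ (m C i) * ℕ→ℚ (i ! ℕ.* (m ∸ i) !)        ≡⟨ ℕ→ℚ-* (m C i) (i ! ℕ.* (m ∸ i) !) ⟨
  ℕ→ℚ ((m C i) ℕ.* (i ! ℕ.* (m ∸ i) !))        ≡⟨ cong ℕ→ℚ C*!*!≡!ℕ ⟩
  ℕ→ℚ (m !)                                    ∎
  where
  instance _ = i !* (m ∸ i) !≢0
  C*!*!≡!ℕ : (m C i) ℕ.* (i ! ℕ.* (m ∸ i) !) ≡ m !
  C*!*!≡!ℕ = trans (cong (ℕ._* (i ! ℕ.* (m ∸ i) !)) (nCk≡n!/k![n-k]! i≤m)) (m/n*n≡m (k![n∸k]!∣n! i≤m))

-- Finite sums and Cauchy products of coefficient sequences

sumTo-suc : ∀ m f → sumTo (suc m) f ≡ f 0 + sumTo m (f ∘ suc)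
sumTo-suc m f = cong (foldr _+_ 0ℚ)
  (trans (map-upTo f (suc (suc m))) (cong (f 0 ∷_) (sym (map-upTo (f ∘ suc) (suc m)))))

sumTo-cong : ∀ m {f g} → (∀ {i} → i ≤ m → f i ≡ g i) → sumTo m f ≡ sumTo m g
sumTo-cong zero    f≡g = cong (_+ 0ℚ) (f≡g z≤n)
sumTo-cong (suc m) {f} {g} f≡g = begin
  sumTo (suc m) f          ≡⟨ sumTo-suc m f ⟩
  f 0 + sumTo m (f ∘ suc)  ≡⟨ cong₂ _+_ (f≡g z≤n) (sumTo-cong m (f≡g ∘ s≤s)) ⟩
  g 0 + sumTo m (g ∘ suc)  ≡⟨ sumTo-suc m g ⟨
  sumTo (suc m) g          ∎

*-distribˡ-sumTo : ∀ c m f → c * sumTo m f ≡ sumTo m (λ i → c * f i)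
*-distribˡ-sumTo c zero    f = solve 2 (λ c a → c :* (a :+ con 0ℚ) := c :* a :+ con 0ℚ) refl c (f 0)
*-distribˡ-sumTo c (suc m) f = begin
  c * sumTo (suc m) f                    ≡⟨ cong (c *_) (sumTo-suc m f) ⟩
  c * (f 0 + sumTo m (f ∘ suc))          ≡⟨ ℚₚ.*-distribˡ-+ c (f 0) _ ⟩
  c * f 0 + c * sumTo m (f ∘ suc)        ≡⟨ cong (λ s → c * f 0 + s) (*-distribˡ-sumTo c m (f ∘ suc)) ⟩
  c * f 0 + sumTo m (λ i → c * f (suc i)) ≡⟨ sumTo-suc m (λ i → c * f i) ⟨
  sumTo (suc m) (λ i → c * f i)          ∎

isPolynomial-sumTo : ∀ m (F : ℕ → ℚ → ℚ) → (∀ i → IsPolynomial (F i)) →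
                     IsPolynomial (λ x → sumTo m (λ i → F i x))
isPolynomial-sumTo zero    F F-poly = isPolynomial-+ (F-poly 0) (isPolynomial-const 0ℚ)
isPolynomial-sumTo (suc m) F F-poly = isPolynomial-resp (λ x → sym (sumTo-suc m (λ i → F i x)))
  (isPolynomial-+ (F-poly 0) (isPolynomial-sumTo m (F ∘ suc) (F-poly ∘ suc)))

infixl 7 _⊛_

_⊛_ : (ℕ → ℚ) → (ℕ → ℚ) → ℕ → ℚ
(a ⊛ b) zero    = a 0 * b 0
(a ⊛ b) (suc m) = a (suc m) * b 0 + (a ⊛ (b ∘ suc)) m

⊛≡sumTo : ∀ a b m → (a ⊛ b) m ≡ sumTo m (λ i → a (m ∸ i) * b i)
⊛≡sumTo a b zero    = sym (ℚₚ.+-identityʳ (a 0 * b 0))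
⊛≡sumTo a b (suc m) = trans (cong (λ s → a (suc m) * b 0 + s) (⊛≡sumTo a (b ∘ suc) m))
                            (sym (sumTo-suc m (λ i → a (suc m ∸ i) * b i)))

⊛-cong : ∀ {a a′ b b′} → a ≗ a′ → b ≗ b′ → a ⊛ b ≗ a′ ⊛ b′
⊛-cong a≗a′ b≗b′ zero    = cong₂ _*_ (a≗a′ 0) (b≗b′ 0)
⊛-cong a≗a′ b≗b′ (suc m) = cong₂ _+_ (cong₂ _*_ (a≗a′ (suc m)) (b≗b′ 0)) (⊛-cong a≗a′ (b≗b′ ∘ suc) m)

⊛-zeroʳ : ∀ a → a ⊛ (λ _ → 0ℚ) ≗ (λ _ → 0ℚ)
⊛-zeroʳ a zero    = ℚₚ.*-zeroʳ (a 0)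
⊛-zeroʳ a (suc m) = trans (cong₂ _+_ (ℚₚ.*-zeroʳ (a (suc m))) (⊛-zeroʳ a m)) (ℚₚ.+-identityˡ 0ℚ)

⊛-linearʳ : ∀ a b b′ c m → (a ⊛ (λ i → b i + c * b′ i)) m ≡ (a ⊛ b) m + c * (a ⊛ b′) m
⊛-linearʳ a b b′ c zero    =
  solve 4 (λ a b b′ c → a :* (b :+ c :* b′) := a :* b :+ c :* (a :* b′)) refl (a 0) (b 0) (b′ 0) c
⊛-linearʳ a b b′ c (suc m) = begin
  a (suc m) * (b 0 + c * b′ 0) + (a ⊛ (λ i → b (suc i) + c * b′ (suc i))) m
    ≡⟨ cong (λ s → a (suc m) * (b 0 + c * b′ 0) + s) (⊛-linearʳ a (b ∘ suc) (b′ ∘ suc) c m) ⟩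
  a (suc m) * (b 0 + c * b′ 0) + ((a ⊛ (b ∘ suc)) m + c * (a ⊛ (b′ ∘ suc)) m)
    ≡⟨ solve 6 (λ a b b′ c u v → a :* (b :+ c :* b′) :+ (u :+ c :* v) := a :* b :+ u :+ c :* (a :* b′ :+ v))
         refl (a (suc m)) (b 0) (b′ 0) c ((a ⊛ (b ∘ suc)) m) ((a ⊛ (b′ ∘ suc)) m) ⟩
  (a ⊛ b) (suc m) + c * (a ⊛ b′) (suc m) ∎

one : ℕ → ℚ
one zero    = 1ℚ
one (suc _) = 0ℚ

⊛-identityʳ : ∀ a → a ⊛ one ≗ a
⊛-identityʳ a zero    = ℚₚ.*-identityʳ (a 0)
⊛-identityʳ a (suc m) = trans (cong₂ _+_ (ℚₚ.*-identityʳ (a (suc m))) (⊛-zeroʳ a m)) (ℚₚ.+-identityʳ (a (suc m)))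

-- times1+ c a is the coefficient sequence of (1 + c t) · a(t).
times1+ : ℚ → (ℕ → ℚ) → ℕ → ℚ
times1+ c a zero    = a 0
times1+ c a (suc i) = a (suc i) + c * a i

⊛-times1+ʳ : ∀ c a b → a ⊛ times1+ c b ≗ times1+ c (a ⊛ b)
⊛-times1+ʳ c a b zero    = refl
⊛-times1+ʳ c a b (suc m) = begin
  a (suc m) * b 0 + (a ⊛ (λ i → b (suc i) + c * b i)) m        ≡⟨ cong (λ s → a (suc m) * b 0 + s) (⊛-linearʳ a (b ∘ suc) b c m) ⟩
  a (suc m) * b 0 + ((a ⊛ (b ∘ suc)) m + c * (a ⊛ b) m)        ≡⟨ ℚₚ.+-assoc (a (suc m) * b 0) _ _ ⟨
  a (suc m) * b 0 + (a ⊛ (b ∘ suc)) m + c * (a ⊛ b) m          ∎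

⊛-times1+ˡ : ∀ c a b → times1+ c a ⊛ b ≗ times1+ c (a ⊛ b)
⊛-times1+ˡ c a b zero          = refl
⊛-times1+ˡ c a b (suc zero)    =
  solve 5 (λ c a₀ a₁ b₀ b₁ → (a₁ :+ c :* a₀) :* b₀ :+ a₀ :* b₁ := a₁ :* b₀ :+ a₀ :* b₁ :+ c :* (a₀ :* b₀))
    refl c (a 0) (a 1) (b 0) (b 1)
⊛-times1+ˡ c a b (suc (suc m)) = begin
  (a (2+m) + c * a (suc m)) * b 0 + (times1+ c a ⊛ (b ∘ suc)) (suc m)
    ≡⟨ cong (λ s → (a (2+m) + c * a (suc m)) * b 0 + s) (⊛-times1+ˡ c a (b ∘ suc) (suc m)) ⟩
  (a (2+m) + c * a (suc m)) * b 0 + ((a ⊛ (b ∘ suc)) (suc m) + c * (a ⊛ (b ∘ suc)) m)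
    ≡⟨ solve 6 (λ c a₂ a₁ b₀ u v → (a₂ :+ c :* a₁) :* b₀ :+ (u :+ c :* v) := a₂ :* b₀ :+ u :+ c :* (a₁ :* b₀ :+ v))
         refl c (a (2+m)) (a (suc m)) (b 0) ((a ⊛ (b ∘ suc)) (suc m)) ((a ⊛ (b ∘ suc)) m) ⟩
  (a ⊛ b) (2+m) + c * (a ⊛ b) (suc m) ∎
  where 2+m = suc (suc m)

record HasLeading (a : ℕ → ℚ) (d : ℕ) (lead : ℚ) : Set where
  field
    leading  : a d ≡ lead
    vanishes : ∀ {k} → d < k → a k ≡ 0ℚ

open HasLeading

one-leading : HasLeading one 0 1ℚ
one-leading .leading            = refl
one-leading .vanishes {suc _} _ = refl

HasLeading-resp : ∀ {a b d l l′} → a ≗ b → l ≡ l′ → HasLeading a d l → HasLeading b d l′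
HasLeading-resp {d = d} a≗b l≡l′ a-lead .leading    = trans (sym (a≗b d)) (trans (a-lead .leading) l≡l′)
HasLeading-resp         a≗b l≡l′ a-lead .vanishes {k} d<k = trans (sym (a≗b k)) (a-lead .vanishes d<k)

times1+-leading : ∀ {c a d l} → HasLeading a d l → HasLeading (times1+ c a) (suc d) (c * l)
times1+-leading {c} {a} {d} {l} a-lead .leading = begin
  a (suc d) + c * a d  ≡⟨ cong₂ (λ u v → u + c * v) (a-lead .vanishes (ℕₚ.n<1+n d)) (a-lead .leading) ⟩
  0ℚ + c * l           ≡⟨ ℚₚ.+-identityˡ (c * l) ⟩
  c * l                ∎
times1+-leading {c} {a} a-lead .vanishes {suc k} (s≤s d<k) = begin
  a (suc k) + c * a k  ≡⟨ cong₂ (λ u v → u + c * v) (a-lead .vanishes (ℕₚ.m<n⇒m<1+n d<k)) (a-lead .vanishes d<k) ⟩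
  0ℚ + c * 0ℚ          ≡⟨ solve 1 (λ c → con 0ℚ :+ c :* con 0ℚ := con 0ℚ) refl c ⟩
  0ℚ                   ∎

h : ℕ → List ℚ → ℚ
h zero    xs       = 1ℚ
h (suc j) []       = 0ℚ
h (suc j) (x ∷ xs) = x * h j (x ∷ xs) + h (suc j) xs

-- E xs and E⁻¹ xs are the coefficient sequences of ∏ (1 + x t) and ∏ (1 + x t)⁻¹, x ∈ xs.
E : List ℚ → ℕ → ℚ
E xs i = σ i xs

E⁻¹ : List ℚ → ℕ → ℚ
E⁻¹ xs j = sign j * h j xs

E-[] : E [] ≗ one
E-[] zero    = refl
E-[] (suc i) = refl

E⁻¹-[] : E⁻¹ [] ≗ one
E⁻¹-[] zero    = ℚₚ.*-identityˡ 1ℚ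
E⁻¹-[] (suc j) = ℚₚ.*-zeroʳ (- sign j)

E-∷ : ∀ x xs → E (x ∷ xs) ≗ times1+ x (E xs)
E-∷ x xs zero    = refl
E-∷ x xs (suc i) = ℚₚ.+-comm (x * σ i xs) (σ (suc i) xs)

E⁻¹-∷ : ∀ x xs → times1+ x (E⁻¹ (x ∷ xs)) ≗ E⁻¹ xs
E⁻¹-∷ x xs zero    = refl
E⁻¹-∷ x xs (suc j) = solve 4 (λ s x u v → :- s :* (x :* u :+ v) :+ x :* (s :* u) := :- s :* v)
                       refl (sign j) x (h j (x ∷ xs)) (h (suc j) xs)

E⁻¹⊛E : ∀ xs → E⁻¹ xs ⊛ E xs ≗ one
E⁻¹⊛E []       k = trans (⊛-cong E⁻¹-[] E-[] k) (⊛-identityʳ one k)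
E⁻¹⊛E (x ∷ xs) k = begin
  (E⁻¹ (x ∷ xs) ⊛ E (x ∷ xs)) k            ≡⟨ ⊛-cong (λ _ → refl) (E-∷ x xs) k ⟩
  (E⁻¹ (x ∷ xs) ⊛ times1+ x (E xs)) k      ≡⟨ ⊛-times1+ʳ x (E⁻¹ (x ∷ xs)) (E xs) k ⟩
  times1+ x (E⁻¹ (x ∷ xs) ⊛ E xs) k        ≡⟨ ⊛-times1+ˡ x (E⁻¹ (x ∷ xs)) (E xs) k ⟨
  (times1+ x (E⁻¹ (x ∷ xs)) ⊛ E xs) k      ≡⟨ ⊛-cong (E⁻¹-∷ x xs) (λ _ → refl) k ⟩
  (E⁻¹ xs ⊛ E xs) k                        ≡⟨ E⁻¹⊛E xs k ⟩
  one k                                    ∎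

-- E⁻¹ (down n) ⊛ E (down (p + n)) is the coefficient sequence of ∏_{k=n+1}^{n+p} (1 + k t).
E⁻¹⊛E-down-leading : ∀ n p → HasLeading (E⁻¹ (down n) ⊛ E (down (p ℕ.+ n))) p (ℕ→ℚ (p ℕ.+ n) ↓ p)
E⁻¹⊛E-down-leading n zero    = HasLeading-resp (sym ∘ E⁻¹⊛E (down n)) refl one-leading
E⁻¹⊛E-down-leading n (suc p) = HasLeading-resp
  (λ k → sym (trans (⊛-cong (λ _ → refl) (E-∷ x (down (p ℕ.+ n))) k) (⊛-times1+ʳ x (E⁻¹ (down n)) _ k)))
  (sym (ℕ→ℚ-suc-↓ (p ℕ.+ n) p))
  (times1+-leading (E⁻¹⊛E-down-leading n p))
  where x = ℕ→ℚ (suc (p ℕ.+ n))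

-- Stirling polynomials

m-[m+c]-1≡-[1+c] : ∀ m c → ℕ→ℚ m - ℕ→ℚ (m ℕ.+ c) - 1ℚ ≡ - ℕ→ℚ (suc c)
m-[m+c]-1≡-[1+c] m c = begin
  ℕ→ℚ m - ℕ→ℚ (m ℕ.+ c) - 1ℚ         ≡⟨ cong (λ y → ℕ→ℚ m - y - 1ℚ) (ℕ→ℚ-+ m c) ⟩
  ℕ→ℚ m - (ℕ→ℚ m + ℕ→ℚ c) - 1ℚ       ≡⟨ solve 2 (λ m c → m :- (m :+ c) :- con 1ℚ := :- (c :+ con 1ℚ)) refl (ℕ→ℚ m) (ℕ→ℚ c) ⟩
  - (ℕ→ℚ c + 1ℚ)                     ≡⟨ cong -_ (ℕ→ℚ-suc c) ⟨
  - ℕ→ℚ (suc c)                      ∎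

module _ {S : ℕ → Poly} (isStirling : IsStirlingFamily S) where

  Q : ℕ → ℚ → ℚ
  Q j x = x ↓ j * eval (S j) x

  isPolynomial-Q : ∀ j → IsPolynomial (Q j)
  isPolynomial-Q j = isPolynomial-* (isPolynomial-↓ j) (isPolynomial-eval (S j))

  S₀≡1 : ∀ x → eval (S 0) x ≡ 1ℚ
  S₀≡1 = polynomial-unique (isPolynomial-eval (S 0)) (isPolynomial-const 1ℚ) 1
           (λ ℓ → trans (sym (ℚₚ.*-identityˡ _)) (isStirling 0 ℓ))

  Q-ℕ : ∀ j n → Q j (ℕ→ℚ n) ≡ ℕ→ℚ (j !) * σ j (down n)
  Q-ℕ zero    zero     = trans (ℚₚ.*-identityˡ _) (S₀≡1 0ℚ)
  Q-ℕ (suc j) zero     = trans (cong (_* eval (S (suc j)) 0ℚ) (0↓suc j))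
                               (trans (ℚₚ.*-zeroˡ (eval (S (suc j)) 0ℚ)) (sym (ℚₚ.*-zeroʳ (ℕ→ℚ (suc j !)))))
  Q-ℕ j       (suc ℓ)  = begin
    ℕ→ℚ (suc ℓ) ↓ j * Sℓ                       ≡⟨ cong (_* Sℓ) (C*!≡↓ (suc ℓ) j) ⟨
    ℕ→ℚ (suc ℓ C j) * ℕ→ℚ (j !) * Sℓ           ≡⟨ solve 3 (λ c f s → c :* f :* s := f :* (c :* s)) refl (ℕ→ℚ (suc ℓ C j)) (ℕ→ℚ (j !)) Sℓ ⟩
    ℕ→ℚ (j !) * (ℕ→ℚ (suc ℓ C j) * Sℓ)         ≡⟨ cong (ℕ→ℚ (j !) *_) (isStirling j ℓ) ⟩
    ℕ→ℚ (j !) * σ j (down (suc ℓ))             ∎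
    where Sℓ = eval (S j) (ℕ→ℚ (suc ℓ))

  -- The recurrence σ_{j+1}(ℓ+1, …, 1) = (ℓ+1) σ_j(ℓ, …, 1) + σ_{j+1}(ℓ, …, 1), extended to all x.
  Q-suc : ∀ j x → Q (suc j) (x + 1ℚ) ≡ Q (suc j) x + ℕ→ℚ (suc j) * (x + 1ℚ) * Q j x
  Q-suc j = polynomial-unique
    (isPolynomial-∘ (isPolynomial-Q (suc j)) x+1-poly)
    (isPolynomial-+ (isPolynomial-Q (suc j))
      (isPolynomial-* (isPolynomial-* (isPolynomial-const (ℕ→ℚ (suc j))) x+1-poly) (isPolynomial-Q j)))
    0 at-ℕ
    where
    x+1-poly = isPolynomial-+ isPolynomial-id (isPolynomial-const 1ℚ)
    at-ℕ : ∀ ℓ → Q (suc j) (ℕ→ℚ ℓ + 1ℚ) ≡ Q (suc j) (ℕ→ℚ ℓ) + ℕ→ℚ (suc j) * (ℕ→ℚ ℓ + 1ℚ) * Q j (ℕ→ℚ ℓ)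
    at-ℕ ℓ = begin
      Q (suc j) (ℕ→ℚ ℓ + 1ℚ)                   ≡⟨ cong (Q (suc j)) (ℕ→ℚ-suc ℓ) ⟨
      Q (suc j) (ℕ→ℚ (suc ℓ))                  ≡⟨ Q-ℕ (suc j) (suc ℓ) ⟩
      ℕ→ℚ (suc j !) * (ℕ→ℚ (suc ℓ) * e + e′)   ≡⟨ cong (_* (ℕ→ℚ (suc ℓ) * e + e′)) (ℕ→ℚ-* (suc j) (j !)) ⟩
      ℕ→ℚ (suc j) * j! * (ℕ→ℚ (suc ℓ) * e + e′)
        ≡⟨ solve 5 (λ a f x e e′ → a :* f :* (x :* e :+ e′) := a :* f :* e′ :+ a :* x :* (f :* e))
             refl (ℕ→ℚ (suc j)) j! (ℕ→ℚ (suc ℓ)) e e′ ⟩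
      ℕ→ℚ (suc j) * j! * e′ + ℕ→ℚ (suc j) * ℕ→ℚ (suc ℓ) * (j! * e)
        ≡⟨ cong₂ (λ u v → u * e′ + ℕ→ℚ (suc j) * ℕ→ℚ (suc ℓ) * v) (sym (ℕ→ℚ-* (suc j) (j !))) (sym (Q-ℕ j ℓ)) ⟩
      ℕ→ℚ (suc j !) * e′ + ℕ→ℚ (suc j) * ℕ→ℚ (suc ℓ) * Q j (ℕ→ℚ ℓ)
        ≡⟨ cong₂ (λ u y → u + ℕ→ℚ (suc j) * y * Q j (ℕ→ℚ ℓ)) (sym (Q-ℕ (suc j) ℓ)) (ℕ→ℚ-suc ℓ) ⟩
      Q (suc j) (ℕ→ℚ ℓ) + ℕ→ℚ (suc j) * (ℕ→ℚ ℓ + 1ℚ) * Q j (ℕ→ℚ ℓ) ∎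
      where
      j! = ℕ→ℚ (j !)
      e  = σ j (down ℓ)
      e′ = σ (suc j) (down ℓ)

  Q-pred : ∀ j x → Q (suc j) x ≡ Q (suc j) (x + 1ℚ) - ℕ→ℚ (suc j) * (x + 1ℚ) * Q j x
  Q-pred j x = trans (solve 2 (λ q r → q := q :+ r :- r) refl (Q (suc j) x) r) (cong (_- r) (sym (Q-suc j x)))
    where r = ℕ→ℚ (suc j) * (x + 1ℚ) * Q j x

  Q-neg : ∀ j n → Q j (- ℕ→ℚ (suc n)) ≡ ℕ→ℚ (j !) * h j (down n)
  Q-neg zero    n       = trans (ℚₚ.*-identityˡ _) (S₀≡1 (- ℕ→ℚ (suc n)))
  Q-neg (suc j) zero    = begin
    Q (suc j) (- 1ℚ)                                      ≡⟨ Q-pred j (- 1ℚ) ⟩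
    Q (suc j) 0ℚ - ℕ→ℚ (suc j) * 0ℚ * Q j (- 1ℚ)          ≡⟨ cong (λ q → q - ℕ→ℚ (suc j) * 0ℚ * Q j (- 1ℚ)) (Q-ℕ (suc j) 0) ⟩
    ℕ→ℚ (suc j !) * 0ℚ - ℕ→ℚ (suc j) * 0ℚ * Q j (- 1ℚ)    ≡⟨ solve 3 (λ f a q → f :* con 0ℚ :- a :* con 0ℚ :* q := f :* con 0ℚ)
                                                               refl (ℕ→ℚ (suc j !)) (ℕ→ℚ (suc j)) (Q j (- 1ℚ)) ⟩
    ℕ→ℚ (suc j !) * 0ℚ                                    ∎
  Q-neg (suc j) (suc n) = begin
    Q (suc j) x                                              ≡⟨ Q-pred j x ⟩
    Q (suc j) (x + 1ℚ) - ℕ→ℚ (suc j) * (x + 1ℚ) * Q j x      ≡⟨ cong (λ y → Q (suc j) y - ℕ→ℚ (suc j) * y * Q j x) x+1≡-[1+n] ⟩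
    Q (suc j) (- n+1) - ℕ→ℚ (suc j) * (- n+1) * Q j x        ≡⟨ cong₂ (λ u v → u - ℕ→ℚ (suc j) * (- n+1) * v) (Q-neg (suc j) n) (Q-neg j (suc n)) ⟩
    ℕ→ℚ (suc j !) * h′ - ℕ→ℚ (suc j) * (- n+1) * (j! * h₀)   ≡⟨ cong (λ f → f * h′ - ℕ→ℚ (suc j) * (- n+1) * (j! * h₀)) (ℕ→ℚ-* (suc j) (j !)) ⟩
    ℕ→ℚ (suc j) * j! * h′ - ℕ→ℚ (suc j) * (- n+1) * (j! * h₀)
      ≡⟨ solve 5 (λ a f h′ n h₀ → a :* f :* h′ :- a :* (:- n) :* (f :* h₀) := a :* f :* (n :* h₀ :+ h′))
           refl (ℕ→ℚ (suc j)) j! h′ n+1 h₀ ⟩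
    ℕ→ℚ (suc j) * j! * h (suc j) (down (suc n))              ≡⟨ cong (_* h (suc j) (down (suc n))) (ℕ→ℚ-* (suc j) (j !)) ⟨
    ℕ→ℚ (suc j !) * h (suc j) (down (suc n))                 ∎
    where
    x   = - ℕ→ℚ (suc (suc n))
    n+1 = ℕ→ℚ (suc n)
    j!  = ℕ→ℚ (j !)
    h₀  = h j (down (suc n))
    h′  = h (suc j) (down n)
    x+1≡-[1+n] : x + 1ℚ ≡ - n+1
    x+1≡-[1+n] = trans (cong (λ y → - y + 1ℚ) (ℕ→ℚ-suc (suc n)))
                       (solve 1 (λ n → :- (n :+ con 1ℚ) :+ con 1ℚ := :- n) refl n+1)

  stirlingSum : ℕ → ℚ → ℚ
  stirlingSum m x = sumTo m (λ i → ℕ→ℚ (m C i) * eval (S (m ∸ i)) (ℕ→ℚ m - x - 1ℚ) * eval (S i) x)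

  isPolynomial-stirlingSum : ∀ m → IsPolynomial (stirlingSum m)
  isPolynomial-stirlingSum m =
    isPolynomial-sumTo m (λ i x → ℕ→ℚ (m C i) * eval (S (m ∸ i)) (ℕ→ℚ m - x - 1ℚ) * eval (S i) x) λ i →
      isPolynomial-* (isPolynomial-* (isPolynomial-const (ℕ→ℚ (m C i)))
                                     (isPolynomial-∘ (isPolynomial-eval (S (m ∸ i))) m-x-1-poly))
                     (isPolynomial-eval (S i))
    where
    m-x-1-poly = isPolynomial-- (isPolynomial-- (isPolynomial-const (ℕ→ℚ m)) isPolynomial-id) (isPolynomial-const 1ℚ)

  ↓*stirlingTerm : ∀ {m i} x → i ≤ m →
    x ↓ m * (ℕ→ℚ (m C i) * eval (S (m ∸ i)) (ℕ→ℚ m - x - 1ℚ) * eval (S i) x)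
      ≡ ℕ→ℚ (m C i) * (sign (m ∸ i) * Q (m ∸ i) (ℕ→ℚ m - x - 1ℚ) * Q i x)
  ↓*stirlingTerm {m} {i} x i≤m = begin
    x ↓ m * (c * Sa * Sx)                                      ≡⟨ cong (λ n → x ↓ n * (c * Sa * Sx)) i+j≡m ⟨
    x ↓ (i ℕ.+ j) * (c * Sa * Sx)                              ≡⟨ cong (_* (c * Sa * Sx)) (↓-+-reflect x i j) ⟩
    x ↓ i * (sign j * (ℕ→ℚ (i ℕ.+ j) - x - 1ℚ) ↓ j) * (c * Sa * Sx)
      ≡⟨ cong (λ n → x ↓ i * (sign j * (ℕ→ℚ n - x - 1ℚ) ↓ j) * (c * Sa * Sx)) i+j≡m ⟩
    x ↓ i * (sign j * a ↓ j) * (c * Sa * Sx)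
      ≡⟨ solve 6 (λ f s g c u v → f :* (s :* g) :* (c :* u :* v) := c :* (s :* (g :* u) :* (f :* v)))
           refl (x ↓ i) (sign j) (a ↓ j) c Sa Sx ⟩
    c * (sign j * Q j a * Q i x)                               ∎
    where
    j  = m ∸ i
    a  = ℕ→ℚ m - x - 1ℚ
    c  = ℕ→ℚ (m C i)
    Sa = eval (S j) a
    Sx = eval (S i) x
    i+j≡m = ℕₚ.m+[n∸m]≡n i≤m

  stirlingTerm-ℕ : ∀ {m i} c → i ≤ m →
    ℕ→ℚ (m C i) * (sign (m ∸ i) * Q (m ∸ i) (ℕ→ℚ m - ℕ→ℚ (m ℕ.+ c) - 1ℚ) * Q i (ℕ→ℚ (m ℕ.+ c)))
      ≡ ℕ→ℚ (m !) * (E⁻¹ (down c) (m ∸ i) * E (down (m ℕ.+ c)) i)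
  stirlingTerm-ℕ {m} {i} c i≤m = begin
    b * (s * Q j (ℕ→ℚ m - ℕ→ℚ (m ℕ.+ c) - 1ℚ) * Q i (ℕ→ℚ (m ℕ.+ c)))
      ≡⟨ cong₂ (λ u v → b * (s * u * v)) (trans (cong (Q j) (m-[m+c]-1≡-[1+c] m c)) (Q-neg j c)) (Q-ℕ i (m ℕ.+ c)) ⟩
    b * (s * (j! * hc) * (i! * e))
      ≡⟨ solve 6 (λ b s j! hc i! e → b :* (s :* (j! :* hc) :* (i! :* e)) := b :* (i! :* j!) :* (s :* hc :* e))
           refl b s j! hc i! e ⟩
    b * (i! * j!) * (s * hc * e)   ≡⟨ cong (_* (s * hc * e)) (C*!*!≡! i≤m) ⟩
    ℕ→ℚ (m !) * (s * hc * e)       ∎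
    where
    j  = m ∸ i
    b  = ℕ→ℚ (m C i)
    s  = sign j
    i! = ℕ→ℚ (i !)
    j! = ℕ→ℚ (j !)
    hc = h j (down c)
    e  = σ i (down (m ℕ.+ c))

  stirlingSum-ℕ : ∀ m c → stirlingSum m (ℕ→ℚ (m ℕ.+ c)) ≡ ℕ→ℚ (m !)
  stirlingSum-ℕ m c = *-cancelˡ-≢0 (ℕ→ℚ-↓≢0 m c) (begin
    X ↓ m * stirlingSum m X                    ≡⟨ *-distribˡ-sumTo (X ↓ m) m _ ⟩
    sumTo m (λ i → X ↓ m * term i)             ≡⟨ sumTo-cong m (λ i≤m → trans (↓*stirlingTerm X i≤m) (stirlingTerm-ℕ c i≤m)) ⟩
    sumTo m (λ i → ℕ→ℚ (m !) * coeff i)        ≡⟨ *-distribˡ-sumTo (ℕ→ℚ (m !)) m coeff ⟨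
    ℕ→ℚ (m !) * sumTo m coeff                  ≡⟨ cong (ℕ→ℚ (m !) *_) (⊛≡sumTo (E⁻¹ (down c)) (E (down (m ℕ.+ c))) m) ⟨
    ℕ→ℚ (m !) * (E⁻¹ (down c) ⊛ E (down (m ℕ.+ c))) m
                                               ≡⟨ cong (ℕ→ℚ (m !) *_) (E⁻¹⊛E-down-leading c m .leading) ⟩
    ℕ→ℚ (m !) * X ↓ m                          ≡⟨ ℚₚ.*-comm (ℕ→ℚ (m !)) (X ↓ m) ⟩
    X ↓ m * ℕ→ℚ (m !)                          ∎)
    where
    X = ℕ→ℚ (m ℕ.+ c)
    term : ℕ → ℚ
    term i = ℕ→ℚ (m C i) * eval (S (m ∸ i)) (ℕ→ℚ m - X - 1ℚ) * eval (S i) X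
    coeff : ℕ → ℚ
    coeff i = E⁻¹ (down c) (m ∸ i) * E (down (m ℕ.+ c)) i

  stirlingSum≡! : ∀ m x → stirlingSum m x ≡ ℕ→ℚ (m !)
  stirlingSum≡! m = polynomial-unique (isPolynomial-stirlingSum m) (isPolynomial-const (ℕ→ℚ (m !))) m (stirlingSum-ℕ m)

corollary4p7 : (S : ℕ → Poly) → IsStirlingFamily S → (m : ℕ) (k : ℤ) →
    sumTo m (λ i → ℕ→ℚ (m C i) * eval (S (m ∸ i)) (ℤ→ℚ (+ m ℤ.- k ℤ.- + 1))
                     * eval (S i) (ℤ→ℚ k))
      ≡ ℕ→ℚ (m !)
corollary4p7 S isStirling m k = begin
  sumTo m (λ i → ℕ→ℚ (m C i) * eval (S (m ∸ i)) (ℤ→ℚ (+ m ℤ.- k ℤ.- + 1)) * eval (S i) (ℤ→ℚ k))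
    ≡⟨ cong (λ y → sumTo m (λ i → ℕ→ℚ (m C i) * eval (S (m ∸ i)) y * eval (S i) (ℤ→ℚ k))) (ℤ→ℚ-complement m k) ⟩
  stirlingSum {S} isStirling m (ℤ→ℚ k)
    ≡⟨ stirlingSum≡! {S} isStirling m (ℤ→ℚ k) ⟩
  ℕ→ℚ (m !) ∎
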